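{- Let $G$ be a finite undirected graph (loops and multiple edges allowed), let $e$ be an edge of $G$, and let $v$ be the vertex to which $e$ contracts in $G/e$. Then for all nonnegative integers $k,\ell$, \[ \chi_{G}(k,\ell)=\chi_{G\backslash e}(k,\ell) - \chi_{G/e}(k,\ell) + \ell\cdot \chi_{(G/e)\backslash v}(k,\ell). \]
   Context: For nonnegative integers $k,\ell$, a $(k,\ell)$-coloring of a graph $G$ with vertex set $V$ is a map $\varphi: V\to\{c_1,\dots,c_{k+\ell}\}$ into a fixed set of $k+\ell$ colors; the colors $c_{k+1},\dots,c_{k+\ell}$ are called wildcards. It is proper if whenever vertices $i,j$ are adjacent (including $i=j$ via a loop) and $\varphi(i),\varphi(j)\in\{c_1,\dots,c_k\}$, we have $\varphi(i)\neq\varphi(j)$. $\chi_G(k,\ell)$ denotes the number of proper $(k,\ell)$-colorings of $G$; for the empty graph (no vertices) $\chi$ equals $1$. $G\backslash e$ is $G$ with the edge $e$ removed; $G/e$ is obtained by removing $e$ and identifying its two endpoints; for a subgraph $H$ (e.g. a vertex $v$), $G\backslash H$ is obtained from $G$ by removing $H$ and all edges of $G$ incident to vertices of $H$. -}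

module Defs where

open import Data.Nat using (ℕ; zero; suc; _+_; _<_; _<?_)
open import Data.Fin using (Fin; zero; suc; toℕ; punchOut; _≟_)
open import Data.List using (List; []; _∷_; length; lookup; removeAt; map; concatMap; filter)
open import Data.List.Relation.Unary.All using (All; all?)
open import Data.Product using (Σ; _×_; _,_; proj₁; proj₂)
open import Relation.Binary.PropositionalEquality using (_≡_; _≢_; refl; sym)
open import Relation.Nullary using (Dec; yes; no; ¬_)
open import Relation.Nullary.Decidable using (¬?; _→-dec_)
open import Data.Empty using (⊥)

-- A finite undirected multigraph with loops: vertex set Fin n, and a list
-- (multiset) of edges, each given by its two (unordered) endpoints.
-- Loops are edges (i , i); parallel edges are repeated list entries.
record Graph : Set where
  constructor mkGraph
  field
    n : ℕ
    E : List (Fin n × Fin n)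
open Graph public

Edge : Graph → Set
Edge G = Fin (length (E G))

deleteEdge : (G : Graph) → Edge G → Graph
deleteEdge G e = mkGraph (n G) (removeAt (E G) e)

removeVertexEdges : {m : ℕ} → Fin (suc m) → List (Fin (suc m) × Fin (suc m)) → List (Fin m × Fin m)
removeVertexEdges v [] = []
removeVertexEdges v ((a , b) ∷ es) with v ≟ a | v ≟ b
... | no v≢a | no v≢b = (punchOut v≢a , punchOut v≢b) ∷ removeVertexEdges v es
... | _ | _ = removeVertexEdges v es

removeVertex' : (n : ℕ) → List (Fin n × Fin n) → Fin n → Graph
removeVertex' (suc m) es v = mkGraph m (removeVertexEdges v es)

removeVertex : (G : Graph) → Fin (n G) → Graph
removeVertex G v = removeVertex' (n G) (E G) v

redirect : {n : ℕ} → Fin n → Fin n → Fin n → Fin n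
redirect w u x with x ≟ w
... | yes _ = u
... | no _ = x

redirectEdges : {n : ℕ} → Fin n → Fin n → List (Fin n × Fin n) → List (Fin n × Fin n)
redirectEdges w u = map (λ { (a , b) → (redirect w u a , redirect w u b) })

contract' : (n : ℕ) → (es : List (Fin n × Fin n)) → Fin n → Fin n → Σ Graph (λ H → Fin (Graph.n H))
contract' (suc m) es u w with u ≟ w
... | yes _ = mkGraph (suc m) es , u
... | no u≢w = mkGraph m (removeVertexEdges w (redirectEdges w u es))
             , punchOut {i = w} {j = u} (λ eq → u≢w (sym eq))

-- If e is a loop, G / e = G \ e and v is the endpoint of e. Otherwise the
-- endpoint w is identified with the endpoint u (edges at w are moved to u,
-- then the isolated vertex w is deleted); v is the image of u.
contractWithVertex : (G : Graph) → Edge G → Σ Graph (λ H → Fin (Graph.n H))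
contractWithVertex G e =
  contract' (n G) (removeAt (E G) e) (proj₁ (lookup (E G) e)) (proj₂ (lookup (E G) e))

contractEdge : (G : Graph) → Edge G → Graph
contractEdge G e = proj₁ (contractWithVertex G e)

contractedVertex : (G : Graph) → (e : Edge G) → Fin (n (contractEdge G e))
contractedVertex G e = proj₂ (contractWithVertex G e)

-- (k , ℓ)-colourings: maps into Fin (k + ℓ); colours c with toℕ c < k are the
-- ordinary colours c_1..c_k, the remaining ℓ colours are wildcards.
Colouring : (k ℓ : ℕ) → ℕ → Set
Colouring k ℓ n = Fin n → Fin (k + ℓ)

EdgeOK : {n : ℕ} (k ℓ : ℕ) → Colouring k ℓ n → Fin n × Fin n → Set
EdgeOK k ℓ φ (i , j) = toℕ (φ i) < k → toℕ (φ j) < k → ¬ (φ i ≡ φ j)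

edgeOK? : {n : ℕ} (k ℓ : ℕ) (φ : Colouring k ℓ n) (ij : Fin n × Fin n) → Dec (EdgeOK k ℓ φ ij)
edgeOK? k ℓ φ (i , j) = (toℕ (φ i) <? k) →-dec ((toℕ (φ j) <? k) →-dec ¬? (φ i ≟ φ j))

Proper : (k ℓ : ℕ) (G : Graph) → Colouring k ℓ (n G) → Set
Proper k ℓ G φ = All (EdgeOK k ℓ φ) (E G)

proper? : (k ℓ : ℕ) (G : Graph) (φ : Colouring k ℓ (n G)) → Dec (Proper k ℓ G φ)
proper? k ℓ G φ = all? (edgeOK? k ℓ φ) (E G)

allFin : (c : ℕ) → List (Fin c)
allFin zero = []
allFin (suc c) = zero ∷ map suc (allFin c)

allMaps : (n c : ℕ) → List (Fin n → Fin c)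
allMaps zero c = (λ ()) ∷ []
allMaps (suc n) c =
  concatMap (λ x → map (λ f → λ { zero → x ; (suc i) → f i }) (allMaps n c)) (allFin c)

χ : Graph → ℕ → ℕ → ℕ
χ G k ℓ = length (filter (proper? k ℓ G) (allMaps (n G) (k + ℓ)))

-- Count the proper colourings of G \ e. Those respecting e are exactly the colourings of G; those
-- violating it give both ends of e one common ordinary colour. The colourings of G \ e giving both
-- ends a common colour are the colourings of G / e, and those among them whose common colour is one
-- of the ℓ wildcards number ℓ · χ((G / e) \ v), as a wildcard vertex constrains none of its
-- neighbours. Hence χ(G \ e) + ℓ · χ((G / e) \ v) = χ(G) + χ(G / e).

module Submission where

open import Defs
open import Data.Nat using (ℕ)
open import Relation.Binary.PropositionalEquality using (_≡_)

open import Data.Empty using (⊥-elim)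
open import Data.Fin using (Fin; zero; suc; toℕ; punchOut; _≟_)
open import Data.Fin.Properties using (suc-injective; punchIn-punchOut)
open import Data.List using (List; []; _∷_; _++_; length; lookup; removeAt; map; filter; concatMap)
open import Data.List.Properties using (length-++; filter-++; concatMap-map)
open import Data.List.Relation.Unary.All as All using (All; []; _∷_; all?)
open import Data.List.Relation.Unary.All.Properties using (map⁺; map⁻)
open import Data.Product using (_×_; _,_; proj₁; proj₂)
open import Data.Sum using (_⊎_; inj₁; inj₂)
open import Data.Vec.Functional using (insertAt)
open import Data.Vec.Functional.Properties using (insertAt-lookup; insertAt-punchIn)
open import Function using (_∘_; id)
open import Relation.Binary.Definitions using (_Respects_)
open import Relation.Binary.PropositionalEquality
  using (_≢_; _≗_; refl; sym; trans; cong; cong₂; subst; subst₂; module ≡-Reasoning)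
open import Relation.Nullary using (Dec; yes; no; does; ¬_; contradiction)
open import Relation.Nullary.Decidable using (_×-dec_; ¬?)

-- ℕ arithmetic is opened only inside this module, so that the ℤ operators of the theorem are
-- unambiguous.
module _ where
  open import Data.Bool using (true; false)
  open import Data.Nat using (zero; suc; _+_; _*_; _<_; _<?_; s≤s; s≤s⁻¹; z≤n)
  open import Data.Nat.Properties
    using (+-0-commutativeMonoid; +-*-semiring; +-identityʳ; *-identityˡ; *-identityʳ)
  open import Data.Nat.Tactic.RingSolver using (solve-∀)
  open import Algebra.Properties.CommutativeMonoid.Sum +-0-commutativeMonoid
    using (sum-syntax; sum-cong-≗; sum-replicate-zero; ∑-distrib-+; ∑-comm)
  open import Algebra.Properties.Semiring.Sum +-*-semiring using (*-distribˡ-sum; *-distribʳ-sum)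
  open ≡-Reasoning

  private variable
    A : Set
    P Q : Set
    m : ℕ

  𝟙 : Dec P → ℕ
  𝟙 (yes _) = 1
  𝟙 (no _)  = 0

  𝟙-cong : (p : Dec P) (q : Dec Q) → (P → Q) → (Q → P) → 𝟙 p ≡ 𝟙 q
  𝟙-cong (yes _) (yes _) _   _   = refl
  𝟙-cong (yes p) (no ¬q) p→q _   = contradiction (p→q p) ¬q
  𝟙-cong (no ¬p) (yes q) _   q→p = contradiction (q→p q) ¬p
  𝟙-cong (no _)  (no _)  _   _   = refl

  𝟙-yes : (p : Dec P) → P → 𝟙 p ≡ 1
  𝟙-yes p x = 𝟙-cong p (yes x) id id

  𝟙-yes-* : (p : Dec P) → P → ∀ a → 𝟙 p * a ≡ a
  𝟙-yes-* p x a = trans (cong (_* a) (𝟙-yes p x)) (*-identityˡ a)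

  𝟙-no : (p : Dec P) → ¬ P → 𝟙 p ≡ 0
  𝟙-no p ¬x = 𝟙-cong p (no ¬x) id id

  𝟙-×-dec : (p : Dec P) (q : Dec Q) → 𝟙 (p ×-dec q) ≡ 𝟙 p * 𝟙 q
  𝟙-×-dec (yes _) (yes _) = refl
  𝟙-×-dec (yes _) (no _)  = refl
  𝟙-×-dec (no _)  _       = refl

  𝟙-+-𝟙-¬? : (p : Dec P) → 𝟙 p + 𝟙 (¬? p) ≡ 1
  𝟙-+-𝟙-¬? (yes _) = refl
  𝟙-+-𝟙-¬? (no _)  = refl

  𝟙-*-cong : (p : Dec P) {a b : ℕ} → (P → a ≡ b) → 𝟙 p * a ≡ 𝟙 p * b
  𝟙-*-cong (yes x) a≡b = cong (1 *_) (a≡b x)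
  𝟙-*-cong (no _)  _   = refl

  insertAt-zero-cong : {φ ψ : Fin m → A} (x : A) → φ ≗ ψ → insertAt φ zero x ≗ insertAt ψ zero x
  insertAt-zero-cong x φ≗ψ zero    = refl
  insertAt-zero-cong x φ≗ψ (suc j) = φ≗ψ j

  insertAt-punchOut : (f : Fin m → A) {i j : Fin (suc m)} (i≢j : i ≢ j) (x : A) →
    insertAt f i x j ≡ f (punchOut i≢j)
  insertAt-punchOut f {i} i≢j x =
    trans (cong (insertAt f i x) (sym (punchIn-punchOut i≢j))) (insertAt-punchIn f i x (punchOut i≢j))

  ∑-const : ∀ n a → ∑[ i < n ] a ≡ n * a
  ∑-const zero    a = refl
  ∑-const (suc n) a = cong (a +_) (∑-const n a)

  ∑-select : {c : ℕ} (y : Fin c) (g : Fin c → ℕ) → ∑[ x < c ] (𝟙 (y ≟ x) * g x) ≡ g y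
  ∑-select {suc c} zero g = begin
    1 * g zero + ∑[ x < c ] 0  ≡⟨ cong₂ _+_ (*-identityˡ (g zero)) (sum-replicate-zero c) ⟩
    g zero + 0                 ≡⟨ +-identityʳ (g zero) ⟩
    g zero                     ∎
  ∑-select {suc c} (suc y) g = trans
    (sum-cong-≗ λ x → cong (_* g (suc x)) (𝟙-cong (suc y ≟ suc x) (y ≟ x) suc-injective (cong suc)))
    (∑-select y (g ∘ suc))

  wildcard? : {c : ℕ} (k : ℕ) (x : Fin c) → Dec (¬ toℕ x < k)
  wildcard? k x = ¬? (toℕ x <? k)

  ∑-wildcard : ∀ k ℓ → ∑[ x < k + ℓ ] 𝟙 (wildcard? k x) ≡ ℓ
  ∑-wildcard zero ℓ = begin
    ∑[ x < ℓ ] 𝟙 (wildcard? 0 x)  ≡⟨ sum-cong-≗ {ℓ} (λ x → 𝟙-yes (wildcard? 0 x) λ ()) ⟩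
    ∑[ x < ℓ ] 1                  ≡⟨ ∑-const ℓ 1 ⟩
    ℓ * 1                         ≡⟨ *-identityʳ ℓ ⟩
    ℓ                             ∎
  ∑-wildcard (suc k) ℓ = begin
    𝟙 (wildcard? (suc k) (zero {k + ℓ})) + ∑[ x < k + ℓ ] 𝟙 (wildcard? (suc k) (suc x))
      ≡⟨ cong₂ _+_ (𝟙-no (wildcard? (suc k) (zero {k + ℓ})) (λ zero-wild → zero-wild (s≤s z≤n)))
                   (sum-cong-≗ {k + ℓ} λ x → 𝟙-cong (wildcard? (suc k) (suc x)) (wildcard? k x)
                                             (λ x-wild x<k → x-wild (s≤s x<k))
                                             (λ x-wild x<k → x-wild (s≤s⁻¹ x<k))) ⟩
    ∑[ x < k + ℓ ] 𝟙 (wildcard? k x)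
      ≡⟨ ∑-wildcard k ℓ ⟩
    ℓ ∎

  ∑Maps : (m c : ℕ) → ((Fin m → Fin c) → ℕ) → ℕ
  ∑Maps zero    c F = F (λ ())
  ∑Maps (suc m) c F = ∑[ x < c ] ∑Maps m c (λ f → F (insertAt f zero x))

  Extensional : {c : ℕ} → ((Fin m → Fin c) → ℕ) → Set
  Extensional F = ∀ {φ ψ} → φ ≗ ψ → F φ ≡ F ψ

  ∑Maps-cong : ∀ m c {F G : (Fin m → Fin c) → ℕ} → (∀ φ → F φ ≡ G φ) → ∑Maps m c F ≡ ∑Maps m c G
  ∑Maps-cong zero    c F≡G = F≡G _
  ∑Maps-cong (suc m) c F≡G = sum-cong-≗ {c} λ x → ∑Maps-cong m c (λ f → F≡G (insertAt f zero x))

  ∑Maps-distrib-+ : ∀ m c (F G : (Fin m → Fin c) → ℕ) →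
    ∑Maps m c (λ φ → F φ + G φ) ≡ ∑Maps m c F + ∑Maps m c G
  ∑Maps-distrib-+ zero    c F G = refl
  ∑Maps-distrib-+ (suc m) c F G =
    trans (sum-cong-≗ {c} λ x → ∑Maps-distrib-+ m c (λ f → F (insertAt f zero x)) (λ f → G (insertAt f zero x)))
          (∑-distrib-+ {c} _ _)

  *-distribˡ-∑Maps : ∀ m c a (F : (Fin m → Fin c) → ℕ) → a * ∑Maps m c F ≡ ∑Maps m c (λ φ → a * F φ)
  *-distribˡ-∑Maps zero    c a F = refl
  *-distribˡ-∑Maps (suc m) c a F =
    trans (*-distribˡ-sum {c} a _) (sum-cong-≗ {c} λ x → *-distribˡ-∑Maps m c a _)

  ∑-∑Maps-comm : ∀ d m c (F : Fin d → (Fin m → Fin c) → ℕ) →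
    ∑[ x < d ] ∑Maps m c (F x) ≡ ∑Maps m c (λ φ → ∑[ x < d ] F x φ)
  ∑-∑Maps-comm d zero    c F = refl
  ∑-∑Maps-comm d (suc m) c F =
    trans (∑-comm {d} {c} λ x y → ∑Maps m c (λ f → F x (insertAt f zero y)))
          (sum-cong-≗ {c} λ y → ∑-∑Maps-comm d m c (λ x f → F x (insertAt f zero y)))

  ∑Maps-insertAt : ∀ m c (p : Fin (suc m)) {F : (Fin (suc m) → Fin c) → ℕ} → Extensional F →
    ∑Maps (suc m) c F ≡ ∑[ x < c ] ∑Maps m c (λ f → F (insertAt f p x))
  ∑Maps-insertAt m       c zero    F-ext = refl
  ∑Maps-insertAt (suc m) c (suc p) {F} F-ext = begin
    ∑[ y < c ] ∑Maps (suc m) c (λ g → F (insertAt g zero y))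
      ≡⟨ sum-cong-≗ {c} (λ y → ∑Maps-insertAt m c p (F-ext ∘ insertAt-zero-cong y)) ⟩
    ∑[ y < c ] ∑[ x < c ] ∑Maps m c (λ f → F (insertAt (insertAt f p x) zero y))
      ≡⟨ ∑-comm {c} {c} (λ y x → ∑Maps m c (λ f → F (insertAt (insertAt f p x) zero y))) ⟩
    ∑[ x < c ] ∑[ y < c ] ∑Maps m c (λ f → F (insertAt (insertAt f p x) zero y))
      ≡⟨ sum-cong-≗ {c} (λ x → sum-cong-≗ {c} λ y → ∑Maps-cong m c λ f → F-ext (exchange f x y)) ⟩
    ∑[ x < c ] ∑[ y < c ] ∑Maps m c (λ f → F (insertAt (insertAt f zero y) (suc p) x))
      ∎
    where
    exchange : ∀ f x y → insertAt (insertAt f p x) zero y ≗ insertAt (insertAt f zero y) (suc p) x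
    exchange f x y zero    = refl
    exchange f x y (suc j) = refl

  ∑Maps-identify : ∀ m c (u w : Fin (suc m)) (w≢u : w ≢ u) {F : (Fin (suc m) → Fin c) → ℕ} →
    Extensional F →
    ∑Maps (suc m) c (λ φ → 𝟙 (φ u ≟ φ w) * F φ)
      ≡ ∑Maps m c (λ ψ → F (insertAt ψ w (ψ (punchOut w≢u))))
  ∑Maps-identify m c u w w≢u {F} F-ext = begin
    ∑Maps (suc m) c (λ φ → 𝟙 (φ u ≟ φ w) * F φ)
      ≡⟨ ∑Maps-insertAt m c w (λ φ≗ψ → cong₂ _*_ (𝟙-≟-cong (φ≗ψ u) (φ≗ψ w)) (F-ext φ≗ψ)) ⟩
    ∑[ x < c ] ∑Maps m c (λ ψ → 𝟙 (insertAt ψ w x u ≟ insertAt ψ w x w) * F (insertAt ψ w x))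
      ≡⟨ sum-cong-≗ {c} (λ x → ∑Maps-cong m c λ ψ → cong (_* F (insertAt ψ w x))
                       (𝟙-≟-cong (insertAt-punchOut ψ w≢u x) (insertAt-lookup ψ w x))) ⟩
    ∑[ x < c ] ∑Maps m c (λ ψ → 𝟙 (ψ (punchOut w≢u) ≟ x) * F (insertAt ψ w x))
      ≡⟨ ∑-∑Maps-comm c m c _ ⟩
    ∑Maps m c (λ ψ → ∑[ x < c ] (𝟙 (ψ (punchOut w≢u) ≟ x) * F (insertAt ψ w x)))
      ≡⟨ ∑Maps-cong m c (λ ψ → ∑-select (ψ (punchOut w≢u)) _) ⟩
    ∑Maps m c (λ ψ → F (insertAt ψ w (ψ (punchOut w≢u))))
      ∎
    where
    𝟙-≟-cong : ∀ {a a′ b b′ : Fin c} → a ≡ a′ → b ≡ b′ → 𝟙 (a ≟ b) ≡ 𝟙 (a′ ≟ b′)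
    𝟙-≟-cong = cong₂ (λ a b → 𝟙 (a ≟ b))

  length-filter-singleton : {P : A → Set} (P? : ∀ x → Dec (P x)) (x : A) →
    length (filter P? (x ∷ [])) ≡ 𝟙 (P? x)
  length-filter-singleton P? x with P? x
  ... | yes _ = refl
  ... | no _  = refl

  length-filter-map : {B : Set} {P : B → Set} (P? : ∀ y → Dec (P y)) (g : A → B) (xs : List A) →
    length (filter P? (map g xs)) ≡ length (filter (P? ∘ g) xs)
  length-filter-map P? g []       = refl
  length-filter-map P? g (x ∷ xs) with does (P? (g x))
  ... | true  = cong suc (length-filter-map P? g xs)
  ... | false = length-filter-map P? g xs

  length-filter-concatMap-allFin : {c : ℕ} {P : A → Set} (P? : ∀ x → Dec (P x)) (h : Fin c → List A) →
    length (filter P? (concatMap h (allFin c))) ≡ ∑[ x < c ] length (filter P? (h x))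
  length-filter-concatMap-allFin {c = zero}  P? h = refl
  length-filter-concatMap-allFin {c = suc c} P? h = begin
    length (filter P? (h zero ++ concatMap h (map suc (allFin c))))
      ≡⟨ cong length (filter-++ P? (h zero) _) ⟩
    length (filter P? (h zero) ++ filter P? (concatMap h (map suc (allFin c))))
      ≡⟨ length-++ (filter P? (h zero)) ⟩
    length (filter P? (h zero)) + length (filter P? (concatMap h (map suc (allFin c))))
      ≡⟨ cong (λ ys → length (filter P? (h zero)) + length (filter P? ys))
              (concatMap-map h suc (allFin c)) ⟩
    length (filter P? (h zero)) + length (filter P? (concatMap (h ∘ suc) (allFin c)))
      ≡⟨ cong (length (filter P? (h zero)) +_) (length-filter-concatMap-allFin P? (h ∘ suc)) ⟩
    length (filter P? (h zero)) + ∑[ x < c ] length (filter P? (h (suc x)))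
      ∎

  length-filter-allMaps : ∀ m c {P : (Fin m → Fin c) → Set} (P? : ∀ φ → Dec (P φ)) → P Respects _≗_ →
    length (filter P? (allMaps m c)) ≡ ∑Maps m c (λ φ → 𝟙 (P? φ))
  length-filter-allMaps zero c P? P-resp =
    trans (length-filter-singleton P? _) (𝟙-cong (P? _) (P? _) (P-resp λ ()) (P-resp λ ()))
  length-filter-allMaps (suc m) c P? P-resp =
    trans (length-filter-concatMap-allFin {c = c} P? _) (sum-cong-≗ {c} λ x →
      trans (length-filter-map P? _ (allMaps m c))
            (count-extensions x _ λ f → λ { zero → refl ; (suc i) → refl }))
    where
    -- allMaps extends f by a pattern-matching lambda that agrees with insertAt f zero x only pointwise.
    count-extensions : ∀ x (cons : (Fin m → Fin c) → Fin (suc m) → Fin c) →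
      (∀ f → cons f ≗ insertAt f zero x) →
      length (filter (P? ∘ cons) (allMaps m c)) ≡ ∑Maps m c (λ f → 𝟙 (P? (insertAt f zero x)))
    count-extensions x cons cons≗ = trans
      (length-filter-allMaps m c (P? ∘ cons) λ {φ} {ψ} φ≗ψ → P-resp λ i →
        trans (cons≗ φ i) (trans (insertAt-zero-cong x φ≗ψ i) (sym (cons≗ ψ i))))
      (∑Maps-cong m c λ f → 𝟙-cong (P? _) (P? _) (P-resp (cons≗ f)) (P-resp (sym ∘ cons≗ f)))

  All-removeAt⁺ : {P : A → Set} (xs : List A) (i : Fin (length xs)) →
    All P xs → P (lookup xs i) × All P (removeAt xs i)
  All-removeAt⁺ (x ∷ xs) zero    (px ∷ pxs) = px , pxs
  All-removeAt⁺ (x ∷ xs) (suc i) (px ∷ pxs) =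
    let pxᵢ , pxs′ = All-removeAt⁺ xs i pxs in pxᵢ , px ∷ pxs′

  All-removeAt⁻ : {P : A → Set} (xs : List A) (i : Fin (length xs)) →
    P (lookup xs i) → All P (removeAt xs i) → All P xs
  All-removeAt⁻ (x ∷ xs) zero    pxᵢ pxs        = pxᵢ ∷ pxs
  All-removeAt⁻ (x ∷ xs) (suc i) pxᵢ (px ∷ pxs) = px ∷ All-removeAt⁻ xs i pxᵢ pxs

  p+q*[w*p]≡o*p+q*[1*p] : ∀ o q l w p → o + q * l ≡ 1 → l + w ≡ 1 →
    p + q * (w * p) ≡ o * p + q * (1 * p)
  p+q*[w*p]≡o*p+q*[1*p] o q l w p o+q*l≡1 l+w≡1 = begin
    p + q * (w * p)                ≡⟨ cong (_+ q * (w * p)) (sym (*-identityˡ p)) ⟩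
    1 * p + q * (w * p)            ≡⟨ cong (λ t → t * p + q * (w * p)) (sym o+q*l≡1) ⟩
    (o + q * l) * p + q * (w * p)  ≡⟨ regroup o q l w p ⟩
    o * p + q * ((l + w) * p)      ≡⟨ cong (λ t → o * p + q * (t * p)) l+w≡1 ⟩
    o * p + q * (1 * p)            ∎
    where
    regroup : ∀ o q l w p → (o + q * l) * p + q * (w * p) ≡ o * p + q * ((l + w) * p)
    regroup = solve-∀

  -- EdgeOK k ℓ φ (a , b) is definitionally Compatible k (φ a) (φ b).
  Compatible : {c : ℕ} → ℕ → Fin c → Fin c → Set
  Compatible k x y = toℕ x < k → toℕ y < k → x ≢ y

  incompatible : ∀ {c k} {x y : Fin c} → ¬ Compatible k x y → x ≡ y × toℕ x < k
  incompatible {k = k} {x} {y} ¬ok with toℕ x <? k | x ≟ y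
  ... | yes x<k | yes x≡y = x≡y , x<k
  ... | yes _   | no x≢y  = contradiction (λ _ _ → x≢y) ¬ok
  ... | no x≮k  | _       = contradiction (λ x<k → contradiction x<k x≮k) ¬ok

  Touches : Fin m → Fin m × Fin m → Set
  Touches v (a , b) = v ≡ a ⊎ v ≡ b

  module _ (k ℓ : ℕ) where

    properOn? : (es : List (Fin m × Fin m)) (φ : Colouring k ℓ m) → Dec (All (EdgeOK k ℓ φ) es)
    properOn? es φ = all? (edgeOK? k ℓ φ) es

    All-EdgeOK-≗ : {φ ψ : Colouring k ℓ m} → φ ≗ ψ → ∀ es → All (EdgeOK k ℓ φ) es → All (EdgeOK k ℓ ψ) es
    All-EdgeOK-≗ φ≗ψ es = All.map λ {(a , b)} → subst₂ (Compatible k) (φ≗ψ a) (φ≗ψ b)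

    𝟙-properOn-≗ : {φ ψ : Colouring k ℓ m} → φ ≗ ψ → ∀ es → 𝟙 (properOn? es φ) ≡ 𝟙 (properOn? es ψ)
    𝟙-properOn-≗ φ≗ψ es =
      𝟙-cong (properOn? es _) (properOn? es _) (All-EdgeOK-≗ φ≗ψ es) (All-EdgeOK-≗ (sym ∘ φ≗ψ) es)

    χ-as-∑Maps : (G : Graph) → χ G k ℓ ≡ ∑Maps (n G) (k + ℓ) (λ φ → 𝟙 (proper? k ℓ G φ))
    χ-as-∑Maps G = length-filter-allMaps (n G) (k + ℓ) (proper? k ℓ G) (λ φ≗ψ → All-EdgeOK-≗ φ≗ψ (E G))

    χ-as-∑Maps-deleteEdge : (G : Graph) (e : Edge G) →
      χ G k ℓ ≡ ∑Maps (n G) (k + ℓ) λ φ →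
                  𝟙 (edgeOK? k ℓ φ (lookup (E G) e)) * 𝟙 (properOn? (removeAt (E G) e) φ)
    χ-as-∑Maps-deleteEdge G e = trans (χ-as-∑Maps G) (∑Maps-cong (n G) (k + ℓ) λ φ → trans
      (𝟙-cong (proper? k ℓ G φ) (edgeOK? k ℓ φ (lookup (E G) e) ×-dec properOn? (removeAt (E G) e) φ)
        (All-removeAt⁺ (E G) e) (λ (ok , oks) → All-removeAt⁻ (E G) e ok oks))
      (𝟙-×-dec (edgeOK? k ℓ φ (lookup (E G) e)) (properOn? (removeAt (E G) e) φ)))

    𝟙-edgeOK-split : (φ : Colouring k ℓ m) (a b : Fin m) →
      𝟙 (edgeOK? k ℓ φ (a , b)) + 𝟙 (φ a ≟ φ b) * 𝟙 (toℕ (φ a) <? k) ≡ 1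
    𝟙-edgeOK-split φ a b = begin
      𝟙 ok? + 𝟙 eq? * 𝟙 lt?      ≡⟨ cong (𝟙 ok? +_) (sym (𝟙-×-dec eq? lt?)) ⟩
      𝟙 ok? + 𝟙 (eq? ×-dec lt?)  ≡⟨ cong (𝟙 ok? +_) (𝟙-cong (eq? ×-dec lt?) (¬? ok?) clash incompatible) ⟩
      𝟙 ok? + 𝟙 (¬? ok?)         ≡⟨ 𝟙-+-𝟙-¬? ok? ⟩
      1                          ∎
      where
      ok? = edgeOK? k ℓ φ (a , b)
      eq? = φ a ≟ φ b
      lt? = toℕ (φ a) <? k
      clash : φ a ≡ φ b × toℕ (φ a) < k → ¬ Compatible k (φ a) (φ b)
      clash (φa≡φb , φa<k) ok = ok φa<k (subst (λ z → toℕ z < k) φa≡φb φa<k) φa≡φb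

    module _ {m : ℕ} (f : Colouring k ℓ m) (v : Fin (suc m)) (x : Fin (k + ℓ)) where

      All-EdgeOK-removeVertexEdges⁺ : ∀ es →
        All (EdgeOK k ℓ (insertAt f v x)) es → All (EdgeOK k ℓ f) (removeVertexEdges v es)
      All-EdgeOK-removeVertexEdges⁺ [] [] = []
      All-EdgeOK-removeVertexEdges⁺ ((a , b) ∷ es) (ok ∷ oks) with v ≟ a | v ≟ b
      ... | no v≢a | no v≢b =
        subst₂ (Compatible k) (insertAt-punchOut f v≢a x) (insertAt-punchOut f v≢b x) ok
          ∷ All-EdgeOK-removeVertexEdges⁺ es oks
      ... | yes _  | _      = All-EdgeOK-removeVertexEdges⁺ es oks
      ... | no _   | yes _  = All-EdgeOK-removeVertexEdges⁺ es oks

      All-EdgeOK-removeVertexEdges⁻ : ∀ es →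
        All (λ ab → Touches v ab → EdgeOK k ℓ (insertAt f v x) ab) es →
        All (EdgeOK k ℓ f) (removeVertexEdges v es) → All (EdgeOK k ℓ (insertAt f v x)) es
      All-EdgeOK-removeVertexEdges⁻ [] [] [] = []
      All-EdgeOK-removeVertexEdges⁻ ((a , b) ∷ es) (t ∷ ts) oks with v ≟ a | v ≟ b
      All-EdgeOK-removeVertexEdges⁻ ((a , b) ∷ es) (t ∷ ts) (ok ∷ oks) | no v≢a | no v≢b =
        subst₂ (Compatible k) (sym (insertAt-punchOut f v≢a x)) (sym (insertAt-punchOut f v≢b x)) ok
          ∷ All-EdgeOK-removeVertexEdges⁻ es ts oks
      ... | yes v≡a | _      = t (inj₁ v≡a) ∷ All-EdgeOK-removeVertexEdges⁻ es ts oks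
      ... | no _    | yes v≡b = t (inj₂ v≡b) ∷ All-EdgeOK-removeVertexEdges⁻ es ts oks

    ∑Maps-wildcard-proper : (H : Graph) (v : Fin (n H)) →
      ∑Maps (n H) (k + ℓ) (λ φ → 𝟙 (wildcard? k (φ v)) * 𝟙 (proper? k ℓ H φ))
        ≡ ℓ * χ (removeVertex H v) k ℓ
    ∑Maps-wildcard-proper (mkGraph (suc m) es) v = begin
      ∑Maps (suc m) c (λ φ → 𝟙 (wildcard? k (φ v)) * 𝟙 (properOn? es φ))
        ≡⟨ ∑Maps-insertAt m c v (λ φ≗ψ → cong₂ _*_ (cong (𝟙 ∘ wildcard? k) (φ≗ψ v)) (𝟙-properOn-≗ φ≗ψ es)) ⟩
      ∑[ x < c ] ∑Maps m c (λ f → 𝟙 (wildcard? k (insertAt f v x v)) * 𝟙 (properOn? es (insertAt f v x)))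
        ≡⟨ sum-cong-≗ {c} (λ x → ∑Maps-cong m c (restrict x)) ⟩
      ∑[ x < c ] ∑Maps m c (λ f → 𝟙 (wildcard? k x) * 𝟙 (properOn? es′ f))
        ≡⟨ sum-cong-≗ {c} (λ x → sym (*-distribˡ-∑Maps m c (𝟙 (wildcard? k x)) (𝟙 ∘ properOn? es′))) ⟩
      ∑[ x < c ] (𝟙 (wildcard? k x) * ∑Maps m c (λ f → 𝟙 (properOn? es′ f)))
        ≡⟨ sym (*-distribʳ-sum {c} _ _) ⟩
      (∑[ x < c ] 𝟙 (wildcard? k x)) * ∑Maps m c (λ f → 𝟙 (properOn? es′ f))
        ≡⟨ cong₂ _*_ (∑-wildcard k ℓ) (sym (χ-as-∑Maps (mkGraph m es′))) ⟩
      ℓ * χ (mkGraph m es′) k ℓ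
        ∎
      where
      c = k + ℓ
      es′ = removeVertexEdges v es
      -- An edge at v is harmless because v carries the wildcard x.
      restrict : ∀ x f → 𝟙 (wildcard? k (insertAt f v x v)) * 𝟙 (properOn? es (insertAt f v x))
                         ≡ 𝟙 (wildcard? k x) * 𝟙 (properOn? es′ f)
      restrict x f rewrite insertAt-lookup f v x = 𝟙-*-cong (wildcard? k x) λ x-wild →
        𝟙-cong (properOn? es _) (properOn? es′ f)
          (All-EdgeOK-removeVertexEdges⁺ f v x es)
          (All-EdgeOK-removeVertexEdges⁻ f v x es (All.universal (touching x-wild) es))
        where
        touching : ¬ toℕ x < k → ∀ ab → Touches v ab → EdgeOK k ℓ (insertAt f v x) ab
        touching x-wild (a , b) (inj₁ refl) v<k _ _ =
          x-wild (subst (λ z → toℕ z < k) (insertAt-lookup f v x) v<k)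
        touching x-wild (a , b) (inj₂ refl) _ v<k _ =
          x-wild (subst (λ z → toℕ z < k) (insertAt-lookup f v x) v<k)

    module _ {m : ℕ} (u w : Fin (suc m)) (w≢u : w ≢ u) (ψ : Colouring k ℓ m) where

      glue : Colouring k ℓ (suc m)
      glue = insertAt ψ w (ψ (punchOut w≢u))

      glue-redirect : ∀ a → glue (redirect w u a) ≡ glue a
      glue-redirect a with a ≟ w
      ... | yes refl = trans (insertAt-punchOut ψ w≢u _) (sym (insertAt-lookup ψ w _))
      ... | no _     = refl

      redirect-avoids : ∀ a → w ≢ redirect w u a
      redirect-avoids a with a ≟ w
      ... | yes _   = w≢u
      ... | no a≢w  = a≢w ∘ sym

      All-EdgeOK-glue⁺ : ∀ es → All (EdgeOK k ℓ glue) es →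
        All (EdgeOK k ℓ ψ) (removeVertexEdges w (redirectEdges w u es))
      All-EdgeOK-glue⁺ es oks = All-EdgeOK-removeVertexEdges⁺ ψ w _ (redirectEdges w u es)
        (map⁺ (All.map (λ {(a , b)} → subst₂ (Compatible k) (sym (glue-redirect a)) (sym (glue-redirect b)))
                       oks))

      All-EdgeOK-glue⁻ : ∀ es → All (EdgeOK k ℓ ψ) (removeVertexEdges w (redirectEdges w u es)) →
        All (EdgeOK k ℓ glue) es
      All-EdgeOK-glue⁻ es oks =
        All.map (λ {(a , b)} → subst₂ (Compatible k) (glue-redirect a) (glue-redirect b))
          (map⁻ (All-EdgeOK-removeVertexEdges⁻ ψ w _ (redirectEdges w u es)
            (map⁺ (All.universal untouched es)) oks))
        where
        untouched : ∀ ab → Touches w (redirect w u (proj₁ ab) , redirect w u (proj₂ ab)) → _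
        untouched (a , b) (inj₁ w≡a′) = ⊥-elim (redirect-avoids a w≡a′)
        untouched (a , b) (inj₂ w≡b′) = ⊥-elim (redirect-avoids b w≡b′)

    ∑Maps-contract' : ∀ n es (u w : Fin n) (g : Fin (k + ℓ) → ℕ) →
      ∑Maps n (k + ℓ) (λ φ → 𝟙 (φ u ≟ φ w) * (g (φ u) * 𝟙 (properOn? es φ)))
        ≡ ∑Maps (Graph.n (proj₁ (contract' n es u w))) (k + ℓ)
            (λ ψ → g (ψ (proj₂ (contract' n es u w))) * 𝟙 (proper? k ℓ (proj₁ (contract' n es u w)) ψ))
    ∑Maps-contract' (suc m) es u w g with u ≟ w
    ... | yes refl =
      ∑Maps-cong (suc m) (k + ℓ) λ φ → 𝟙-yes-* (φ u ≟ φ u) refl (g (φ u) * 𝟙 (properOn? es φ))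
    ... | no u≢w = trans
      (∑Maps-identify m (k + ℓ) u w w≢u
        (λ φ≗ψ → cong₂ _*_ (cong g (φ≗ψ u)) (𝟙-properOn-≗ φ≗ψ es)))
      (∑Maps-cong m (k + ℓ) λ ψ → cong₂ _*_
        (cong g (insertAt-punchOut ψ w≢u _))
        (𝟙-cong (properOn? es _) (properOn? _ ψ)
                (All-EdgeOK-glue⁺ u w w≢u ψ es) (All-EdgeOK-glue⁻ u w w≢u ψ es)))
      where
      w≢u : w ≢ u
      w≢u = u≢w ∘ sym

    χ-deletion-contraction : (G : Graph) (e : Edge G) →
      χ (deleteEdge G e) k ℓ + ℓ * χ (removeVertex (contractEdge G e) (contractedVertex G e)) k ℓ
        ≡ χ G k ℓ + χ (contractEdge G e) k ℓ
    χ-deletion-contraction G e = begin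
      χ (deleteEdge G e) k ℓ + ℓ * χ (removeVertex G/e v) k ℓ
        ≡⟨ cong₂ _+_ (χ-as-∑Maps (deleteEdge G e)) (sym wildcard-count) ⟩
      ∑Maps (n G) c proper + ∑Maps (n G) c (λ φ → equal φ * (wild φ * proper φ))
        ≡⟨ sym (∑Maps-distrib-+ (n G) c _ _) ⟩
      ∑Maps (n G) c (λ φ → proper φ + equal φ * (wild φ * proper φ))
        ≡⟨ ∑Maps-cong (n G) c split ⟩
      ∑Maps (n G) c (λ φ → respects φ * proper φ + equal φ * (1 * proper φ))
        ≡⟨ ∑Maps-distrib-+ (n G) c _ _ ⟩
      ∑Maps (n G) c (λ φ → respects φ * proper φ) + ∑Maps (n G) c (λ φ → equal φ * (1 * proper φ))
        ≡⟨ cong₂ _+_ (sym (χ-as-∑Maps-deleteEdge G e)) χ-G/e ⟩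
      χ G k ℓ + χ G/e k ℓ
        ∎
      where
      c = k + ℓ
      es = removeAt (E G) e
      u = proj₁ (lookup (E G) e)
      w = proj₂ (lookup (E G) e)
      G/e = contractEdge G e
      v = contractedVertex G e
      proper equal respects wild : Colouring k ℓ (n G) → ℕ
      proper φ = 𝟙 (properOn? es φ)
      equal φ = 𝟙 (φ u ≟ φ w)
      respects φ = 𝟙 (edgeOK? k ℓ φ (u , w))
      wild φ = 𝟙 (wildcard? k (φ u))

      split : ∀ φ → proper φ + equal φ * (wild φ * proper φ) ≡ respects φ * proper φ + equal φ * (1 * proper φ)
      split φ = p+q*[w*p]≡o*p+q*[1*p] (respects φ) (equal φ) (𝟙 (toℕ (φ u) <? k)) (wild φ) (proper φ)
        (𝟙-edgeOK-split φ u w) (𝟙-+-𝟙-¬? (toℕ (φ u) <? k))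

      wildcard-count : ∑Maps (n G) c (λ φ → equal φ * (wild φ * proper φ)) ≡ ℓ * χ (removeVertex G/e v) k ℓ
      wildcard-count =
        trans (∑Maps-contract' (n G) es u w (𝟙 ∘ wildcard? k)) (∑Maps-wildcard-proper G/e v)

      χ-G/e : ∑Maps (n G) c (λ φ → equal φ * (1 * proper φ)) ≡ χ G/e k ℓ
      χ-G/e = trans (∑Maps-contract' (n G) es u w (λ _ → 1))
                    (trans (∑Maps-cong (n G/e) c λ ψ → *-identityˡ _) (sym (χ-as-∑Maps G/e)))

open import Data.Integer using (ℤ; +_; _+_; _-_; _*_)
open import Data.Integer.Properties using (pos-+; pos-*)
open import Data.Integer.Tactic.RingSolver using (solve-∀)
import Data.Nat as ℕ

o+l*q≡m+n⇒m≡o-n+l*q : ∀ {m n o l q : ℕ} → o ℕ.+ l ℕ.* q ≡ m ℕ.+ n → + m ≡ (+ o - + n) + (+ l) * (+ q)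
o+l*q≡m+n⇒m≡o-n+l*q {m} {n} {o} {l} {q} o+l*q≡m+n = begin
  + m                              ≡⟨ x≡x+y-y (+ m) (+ n) ⟩
  (+ m + + n) - + n                ≡⟨ cong (_- + n) (sym (pos-+ m n)) ⟩
  + (m ℕ.+ n) - + n                ≡⟨ cong (λ t → + t - + n) (sym o+l*q≡m+n) ⟩
  + (o ℕ.+ l ℕ.* q) - + n          ≡⟨ cong (_- + n) (trans (pos-+ o (l ℕ.* q))
                                                            (cong (λ t → + o + t) (pos-* l q))) ⟩
  (+ o + (+ l) * (+ q)) - + n      ≡⟨ x+y-z≡x-z+y (+ o) ((+ l) * (+ q)) (+ n) ⟩
  (+ o - + n) + (+ l) * (+ q)      ∎
  where
  open ≡-Reasoning
  x≡x+y-y : ∀ (x y : ℤ) → x ≡ (x + y) - y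
  x≡x+y-y = solve-∀
  x+y-z≡x-z+y : ∀ (x y z : ℤ) → (x + y) - z ≡ (x - z) + y
  x+y-z≡x-z+y = solve-∀

lemma1p1 : (G : Graph) (e : Edge G) (k ℓ : ℕ) →
    + χ G k ℓ ≡ (+ χ (deleteEdge G e) k ℓ - + χ (contractEdge G e) k ℓ)
    + (+ ℓ) * (+ χ (removeVertex (contractEdge G e) (contractedVertex G e)) k ℓ)
lemma1p1 G e k ℓ = o+l*q≡m+n⇒m≡o-n+l*q {l = ℓ} (χ-deletion-contraction k ℓ G e)
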